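{- Let $G$ be a graph, $C$ a connected component of $G$, and $w\in V(G)\setminus V(C)$. Let $G'$ be the graph with $V(G')=V(G)$ and $E(G')=\big(E(G)\setminus\{wv: v\in N_G(w)\}\big)\cup\{wv: v\in V(C)\}$. If $|V(C)|$ is even and $\nu(C)=|V(C)|/2$, then $\nu(G')\le\nu(G)$.
   Context: $\nu(G)$ denotes the matching number of $G$ (the maximum number of pairwise disjoint edges); $N_G(w)$ is the set of neighbours of $w$ in $G$. -}

module Defs where

open import Data.Nat using (ℕ; _≤_; _*_)
open import Data.Bool using (Bool; true; false; if_then_else_)
open import Data.Fin using (Fin; _≟_)
open import Data.Fin.Subset using (Subset; _∈_; _∉_; ∣_∣)
open import Data.Fin.Subset.Properties using (_∈?_)
open import Data.List using (List; length; concatMap; _∷_; [])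
open import Data.List.Relation.Unary.All using (All)
open import Data.List.Relation.Unary.Unique.Propositional using (Unique)
open import Data.Product using (_×_; _,_; ∃)
open import Relation.Binary.PropositionalEquality using (_≡_)
open import Relation.Nullary.Decidable using (⌊_⌋)
open import Relation.Nullary using (¬_)

record Graph (n : ℕ) : Set where
  field
    adj    : Fin n → Fin n → Bool
    sym    : ∀ u v → adj u v ≡ adj v u
    irrefl : ∀ v → adj v v ≡ false
open Graph public

Edge : ∀ {n} → Graph n → Fin n × Fin n → Set
Edge G (u , v) = adj G u v ≡ true

-- A matching: a list of edges whose endpoints are pairwise distinct
-- (so the edges are pairwise disjoint and no edge is repeated).
endpoints : ∀ {n} → List (Fin n × Fin n) → List (Fin n)
endpoints = concatMap (λ { (u , v) → u ∷ v ∷ [] })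

IsMatching : ∀ {n} → Graph n → List (Fin n × Fin n) → Set
IsMatching G M = All (Edge G) M × Unique (endpoints M)

IsMatchingNumber : ∀ {n} → Graph n → ℕ → Set
IsMatchingNumber G k =
  (∃ λ M → IsMatching G M × length M ≡ k) ×
  (∀ M → IsMatching G M → length M ≤ k)

data Reach {n} (G : Graph n) : Fin n → Fin n → Set where
  here : ∀ {v} → Reach G v v
  step : ∀ {u x v} → adj G u x ≡ true → Reach G x v → Reach G u v

IsComponent : ∀ {n} → Graph n → Subset n → Set
IsComponent G C =
  (∃ λ v → v ∈ C) ×
  (∀ u v → u ∈ C → v ∈ C → Reach G u v) ×
  (∀ u v → u ∈ C → adj G u v ≡ true → v ∈ C)

-- The subgraph induced on C, kept on the vertex set Fin n (vertices
-- outside C become isolated, which does not change the matching number).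
induced : ∀ {n} → Graph n → Subset n → Graph n
induced G C = record
  { adj = a
  ; sym = symP
  ; irrefl = irr }
  where
  open import Relation.Binary.PropositionalEquality using (refl)
  a : Fin _ → Fin _ → Bool
  a u v = if ⌊ u ∈? C ⌋ then (if ⌊ v ∈? C ⌋ then adj G u v else false) else false
  symP : ∀ u v → a u v ≡ a v u
  symP u v with u ∈? C | v ∈? C
  ... | Relation.Nullary.yes _ | Relation.Nullary.yes _ = sym G u v
  ... | Relation.Nullary.yes _ | Relation.Nullary.no _ = refl
  ... | Relation.Nullary.no _ | Relation.Nullary.yes _ = refl
  ... | Relation.Nullary.no _ | Relation.Nullary.no _ = refl
  irr : ∀ v → a v v ≡ false
  irr v with v ∈? C
  ... | Relation.Nullary.yes _ = irrefl G v
  ... | Relation.Nullary.no _ = refl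

-- G' : delete all edges at w, then join w to every vertex of C.
-- (Requires w ∉ C for irreflexivity.)
rewire : ∀ {n} (G : Graph n) (C : Subset n) (w : Fin n) → w ∉ C → Graph n
rewire G C w w∉C = record { adj = a ; sym = symP ; irrefl = irr }
  where
  open import Relation.Binary.PropositionalEquality using (refl)
  open import Relation.Nullary using (yes; no)
  open import Data.Empty using (⊥-elim)
  a : _ → _ → Bool
  a u v with u ≟ w | v ≟ w
  ... | yes _ | _     = ⌊ v ∈? C ⌋
  ... | no _  | yes _ = ⌊ u ∈? C ⌋
  ... | no _  | no _  = adj G u v
  symP : ∀ u v → a u v ≡ a v u
  symP u v with u ≟ w | v ≟ w
  ... | yes refl | yes refl = refl
  ... | yes _ | no _ = refl
  ... | no _ | yes _ = refl
  ... | no _ | no _ = sym G u v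
  irr : ∀ v → a v v ≡ false
  irr v with v ≟ w
  ... | yes refl with v ∈? C
  ...   | yes p = ⊥-elim (w∉C p)
  ...   | no _ = refl
  irr v | no _ = irrefl G v

-- A matching M of G' splits into the edges meeting D = C ∪ {w} and the rest. D is closed under
-- adjacency in G' (C is closed in G, and w is joined only to C), so the first part lies inside D
-- and, since |D| = 2m + 1, has at most m edges. The rest avoids w, so it consists of edges of G
-- disjoint from C; together with a perfect matching of C it is a matching of G with at least
-- |M| edges.

module Submission where

open import Defs hiding (sym)
open import Data.Nat using (ℕ; _≤_; _*_)
open import Data.Fin using (Fin)
open import Data.Fin.Subset using (Subset; _∉_; ∣_∣)
open import Relation.Binary.PropositionalEquality using (_≡_)

open import Data.Bool using (true)
open import Data.Empty using (⊥-elim)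
open import Data.Fin using (_≟_)
open import Data.Fin.Subset using (_∈_; _∪_; ⁅_⁆; _-_; inside; outside)
open import Data.Fin.Subset.Properties
  using (_∈?_; x∈p∪q⁺; x∈p∪q⁻; x∈⁅x⁆; x∈⁅y⁆⇒x≡y; ∣⁅x⁆∣≡1; ∣p∣≤∣x∷p∣;
         x∈p⇒∣p-x∣<∣p∣; x∈p∧x≢y⇒x∈p-y)
open import Data.List using (List; []; _∷_; _++_; length; filter)
open import Data.List.Properties using (length-++)
open import Data.List.Relation.Binary.Sublist.Propositional using (_⊆_; []; _∷_; _∷ʳ_)
open import Data.List.Relation.Binary.Sublist.Propositional.Properties
  using (All-resp-⊆; filter-⊆)
open import Data.List.Relation.Unary.All as All using (All; []; _∷_)
open import Data.List.Relation.Unary.All.Properties using (all-filter; ++⁺)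
open import Data.List.Relation.Unary.AllPairs using (AllPairs; []; _∷_)
open import Data.List.Relation.Unary.Unique.Propositional using (Unique)
import Data.List.Relation.Unary.Unique.Propositional.Properties as Unique
open import Data.Nat using (suc; _+_; z≤n; s≤s)
open import Data.Nat.Properties
  using (≤-trans; ≤-reflexive; ≤-pred; n<1+n; +-suc; +-comm; +-monoʳ-≤; +-monoˡ-≤;
         *-suc; *-cancelˡ-<; module ≤-Reasoning)
open import Data.Vec using ([]; _∷_)
open import Data.Product using (_×_; _,_; proj₁; proj₂; Σ-syntax)
open import Function using (_∘_)
open import Data.Sum using (inj₁; inj₂)
open import Relation.Binary.PropositionalEquality
  using (refl; sym; trans; cong; subst; _≢_; ≢-sym)
open import Relation.Nullary using (Dec; yes; no)
open import Relation.Unary using (Decidable)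
open import Relation.Unary.Properties using (∁?)

2*m≤2*n+1⇒m≤n : ∀ {m n} → 2 * m ≤ 2 * n + 1 → m ≤ n
2*m≤2*n+1⇒m≤n {m} {n} h = ≤-pred (*-cancelˡ-< 2 m (suc n) (begin-strict
  2 * m       ≤⟨ h ⟩
  2 * n + 1   ≡⟨ +-comm (2 * n) 1 ⟩
  suc (2 * n) <⟨ n<1+n _ ⟩
  2 + 2 * n   ≡⟨ *-suc 2 n ⟨
  2 * suc n   ∎))
  where open ≤-Reasoning

module _ {a} {A : Set a} where

  AllPairs-resp-⊆ : ∀ {r} {R : A → A → Set r} {xs ys : List A}
    → xs ⊆ ys → AllPairs R ys → AllPairs R xs
  AllPairs-resp-⊆ []         []       = []
  AllPairs-resp-⊆ (_ ∷ʳ τ)   (_ ∷ ps) = AllPairs-resp-⊆ τ ps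
  AllPairs-resp-⊆ (refl ∷ τ) (r ∷ ps) = All-resp-⊆ τ r ∷ AllPairs-resp-⊆ τ ps

  length-filter-∁ : ∀ {p} {P : A → Set p} (P? : Decidable P) (xs : List A)
    → length xs ≡ length (filter P? xs) + length (filter (∁? P?) xs)
  length-filter-∁ P? []       = refl
  length-filter-∁ P? (x ∷ xs) with P? x
  ... | yes _ = cong suc (length-filter-∁ P? xs)
  ... | no _  = trans (cong suc (length-filter-∁ P? xs)) (sym (+-suc _ _))

∣p∪q∣≤∣p∣+∣q∣ : ∀ {n} (p q : Subset n) → ∣ p ∪ q ∣ ≤ ∣ p ∣ + ∣ q ∣
∣p∪q∣≤∣p∣+∣q∣ [] [] = z≤n
∣p∪q∣≤∣p∣+∣q∣ (outside ∷ p) (outside ∷ q) = ∣p∪q∣≤∣p∣+∣q∣ p q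
∣p∪q∣≤∣p∣+∣q∣ (outside ∷ p) (inside ∷ q) =
  ≤-trans (s≤s (∣p∪q∣≤∣p∣+∣q∣ p q)) (≤-reflexive (sym (+-suc ∣ p ∣ ∣ q ∣)))
∣p∪q∣≤∣p∣+∣q∣ (inside ∷ p) (x ∷ q) =
  s≤s (≤-trans (∣p∪q∣≤∣p∣+∣q∣ p q) (+-monoʳ-≤ ∣ p ∣ (∣p∣≤∣x∷p∣ x q)))

module _ {n : ℕ} where

  Unique∧All∈p⇒length≤∣p∣ : ∀ {p : Subset n} {xs : List (Fin n)}
    → Unique xs → All (_∈ p) xs → length xs ≤ ∣ p ∣
  Unique∧All∈p⇒length≤∣p∣ [] [] = z≤n
  Unique∧All∈p⇒length≤∣p∣ {p} {x ∷ _} (x∉xs ∷ xs!) (x∈p ∷ xs⊆p) =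
    ≤-trans (s≤s (Unique∧All∈p⇒length≤∣p∣ xs! (All.zipWith ∈p-x (xs⊆p , x∉xs))))
            (x∈p⇒∣p-x∣<∣p∣ x∈p)
    where
    ∈p-x : ∀ {y} → y ∈ p × x ≢ y → y ∈ p - x
    ∈p-x (y∈p , x≢y) = x∈p∧x≢y⇒x∈p-y y∈p (≢-sym x≢y)

  Both : (Fin n → Set) → Fin n × Fin n → Set
  Both Q (u , v) = Q u × Q v

  All-endpoints⁺ : ∀ {Q : Fin n → Set} {M} → All (Both Q) M → All Q (endpoints M)
  All-endpoints⁺ []                = []
  All-endpoints⁺ ((qu , qv) ∷ qM) = qu ∷ qv ∷ All-endpoints⁺ qM

  endpoints-⊆ : ∀ {M N : List (Fin n × Fin n)} → M ⊆ N → endpoints M ⊆ endpoints N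
  endpoints-⊆ []         = []
  endpoints-⊆ (_ ∷ʳ τ)   = _ ∷ʳ _ ∷ʳ endpoints-⊆ τ
  endpoints-⊆ (refl ∷ τ) = refl ∷ refl ∷ endpoints-⊆ τ

  endpoints-++ : ∀ (M N : List (Fin n × Fin n)) → endpoints (M ++ N) ≡ endpoints M ++ endpoints N
  endpoints-++ []            N = refl
  endpoints-++ ((u , v) ∷ M) N = cong (λ xs → u ∷ v ∷ xs) (endpoints-++ M N)

  length-endpoints : ∀ (M : List (Fin n × Fin n)) → length (endpoints M) ≡ 2 * length M
  length-endpoints []            = refl
  length-endpoints ((u , v) ∷ M) =
    trans (cong (2 +_) (length-endpoints M)) (sym (*-suc 2 (length M)))

  module _ {G : Graph n} where

    IsMatching-⊆ : ∀ {M N} → M ⊆ N → IsMatching G N → IsMatching G M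
    IsMatching-⊆ τ (edges , unique) =
      All-resp-⊆ τ edges , AllPairs-resp-⊆ (endpoints-⊆ τ) unique

    IsMatching-++ : ∀ {D : Subset n} {M N}
      → All (_∈ D) (endpoints M) → All (_∉ D) (endpoints N)
      → IsMatching G M → IsMatching G N → IsMatching G (M ++ N)
    IsMatching-++ {M = M} {N} M⊆D N∩D=∅ (M-edges , M!) (N-edges , N!) =
      ++⁺ M-edges N-edges ,
      subst Unique (sym (endpoints-++ M N))
        (Unique.++⁺ M! N! λ (x∈M , x∈N) → All.lookup N∩D=∅ x∈N (All.lookup M⊆D x∈M))

    IsMatching⇒2*length≤∣p∣ : ∀ {p : Subset n} {M}
      → IsMatching G M → All (_∈ p) (endpoints M) → 2 * length M ≤ ∣ p ∣
    IsMatching⇒2*length≤∣p∣ {M = M} (_ , M!) M⊆p =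
      subst (_≤ _) (length-endpoints M) (Unique∧All∈p⇒length≤∣p∣ M! M⊆p)

  IsClosed : Graph n → Subset n → Set
  IsClosed G D = ∀ u v → u ∈ D → adj G u v ≡ true → v ∈ D

  module _ {G : Graph n} {D : Subset n} (closed : IsClosed G D) where

    closed-edge-∈ : ∀ {e} → Edge G e → proj₁ e ∈ D → Both (_∈ D) e
    closed-edge-∈ {u , v} uv u∈D = u∈D , closed u v u∈D uv

    closed-edge-∉ : ∀ {e} → Edge G e → proj₁ e ∉ D → Both (_∉ D) e
    closed-edge-∉ {u , v} uv u∉D = u∉D , λ v∈D → u∉D (closed v u v∈D (trans (Graph.sym G v u) uv))

  induced-edge : ∀ {G : Graph n} {C e} → Edge (induced G C) e → Edge G e × Both (_∈ C) e
  induced-edge {C = C} {u , v} uv with u ∈? C | v ∈? C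
  induced-edge uv | yes u∈C | yes v∈C = uv , u∈C , v∈C
  induced-edge () | yes _   | no _
  induced-edge () | no _    | _

  IsMatching-induced : ∀ {G : Graph n} {C M}
    → IsMatching (induced G C) M → IsMatching G M × All (_∈ C) (endpoints M)
  IsMatching-induced {G} {C} (edges , M!) =
    (All.map (proj₁ ∘ induced-edge {G} {C}) edges , M!) ,
    All-endpoints⁺ (All.map (proj₂ ∘ induced-edge {G} {C}) edges)

module Rewiring {n} (G : Graph n) (C : Subset n) (w : Fin n) (w∉C : w ∉ C) where

  G' : Graph n
  G' = rewire G C w w∉C

  D : Subset n
  D = C ∪ ⁅ w ⁆

  rewire-adj-w : ∀ v → adj G' w v ≡ true → v ∈ C
  rewire-adj-w v wv with w ≟ w | v ≟ w
  ... | no w≢w | _ = ⊥-elim (w≢w refl)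
  ... | yes _  | _ with v ∈? C
  ...   | yes v∈C = v∈C

  rewire-adj-other : ∀ {u v} → u ≢ w → v ≢ w → adj G' u v ≡ adj G u v
  rewire-adj-other {u} {v} u≢w v≢w with u ≟ w | v ≟ w
  ... | yes u≡w | _       = ⊥-elim (u≢w u≡w)
  ... | no _    | yes v≡w = ⊥-elim (v≢w v≡w)
  ... | no _    | no _    = refl

  ∉D⇒∉C : ∀ {u} → u ∉ D → u ∉ C
  ∉D⇒∉C u∉D u∈C = u∉D (x∈p∪q⁺ (inj₁ u∈C))

  ∉D⇒≢w : ∀ {u} → u ∉ D → u ≢ w
  ∉D⇒≢w u∉D refl = u∉D (x∈p∪q⁺ (inj₂ (x∈⁅x⁆ w)))

  ∈D∧≢w⇒∈C : ∀ {u} → u ∈ D → u ≢ w → u ∈ C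
  ∈D∧≢w⇒∈C u∈D u≢w with x∈p∪q⁻ C ⁅ w ⁆ u∈D
  ... | inj₁ u∈C  = u∈C
  ... | inj₂ u∈⁅w⁆ = ⊥-elim (u≢w (x∈⁅y⁆⇒x≡y w u∈⁅w⁆))

  rewire-closed : IsClosed G C → IsClosed G' D
  rewire-closed closed u v u∈D uv = by-cases (u ≟ w) (v ≟ w)
    where
    by-cases : Dec (u ≡ w) → Dec (v ≡ w) → v ∈ D
    by-cases (yes u≡w) _          =
      x∈p∪q⁺ (inj₁ (rewire-adj-w v (subst (λ x → adj G' x v ≡ true) u≡w uv)))
    by-cases (no _)    (yes refl) = x∈p∪q⁺ (inj₂ (x∈⁅x⁆ w))
    by-cases (no u≢w)  (no v≢w)   =
      x∈p∪q⁺ (inj₁ (closed u v (∈D∧≢w⇒∈C u∈D u≢w) (trans (sym (rewire-adj-other u≢w v≢w)) uv)))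

  module _ (C-closed : IsClosed G C) {M : List (Fin n × Fin n)} (M-matching : IsMatching G' M) where

    2*length≤∣C∣+1 : All (λ e → proj₁ e ∈ D) M → 2 * length M ≤ ∣ C ∣ + 1
    2*length≤∣C∣+1 M-inside = begin
      2 * length M         ≤⟨ IsMatching⇒2*length≤∣p∣ {G = G'} M-matching (All-endpoints⁺ edges-in-D) ⟩
      ∣ C ∪ ⁅ w ⁆ ∣         ≤⟨ ∣p∪q∣≤∣p∣+∣q∣ C ⁅ w ⁆ ⟩
      ∣ C ∣ + ∣ ⁅ w ⁆ ∣     ≡⟨ cong (∣ C ∣ +_) (∣⁅x⁆∣≡1 w) ⟩
      ∣ C ∣ + 1            ∎
      where
      open ≤-Reasoning
      edges-in-D : All (Both (_∈ D)) M
      edges-in-D = All.zipWith (λ (e , e∈D) → closed-edge-∈ {G = G'} (rewire-closed C-closed) e e∈D)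
                               (proj₁ M-matching , M-inside)

    IsMatching-outside : All (λ e → proj₁ e ∉ D) M → IsMatching G M × All (_∉ C) (endpoints M)
    IsMatching-outside M-outside =
      (All.map proj₁ edges-outside , proj₂ M-matching) , All-endpoints⁺ (All.map proj₂ edges-outside)
      where
      edge-outside : ∀ {e} → Edge G' e → proj₁ e ∉ D → Edge G e × Both (_∉ C) e
      edge-outside {u , v} uv u∉D =
        let (u∉D , v∉D) = closed-edge-∉ {G = G'} (rewire-closed C-closed) uv u∉D
        in trans (sym (rewire-adj-other (∉D⇒≢w u∉D) (∉D⇒≢w v∉D))) uv , ∉D⇒∉C u∉D , ∉D⇒∉C v∉D
      edges-outside : All (λ e → Edge G e × Both (_∉ C) e) M
      edges-outside = All.zipWith (λ (e , e∉D) → edge-outside e e∉D) (proj₁ M-matching , M-outside)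

  matching-split : IsClosed G C → ∀ {M} → IsMatching G' M
    → Σ[ (R , B) ∈ List (Fin n × Fin n) × List (Fin n × Fin n) ]
        length M ≡ length R + length B × 2 * length R ≤ ∣ C ∣ + 1 ×
        IsMatching G B × All (_∉ C) (endpoints B)
  matching-split C-closed {M} M-matching =
    (filter starts-in-D? M , filter (∁? starts-in-D?) M) ,
    length-filter-∁ starts-in-D? M ,
    2*length≤∣C∣+1 C-closed (sub-matching starts-in-D?) (all-filter starts-in-D? M) ,
    IsMatching-outside C-closed (sub-matching (∁? starts-in-D?)) (all-filter (∁? starts-in-D?) M)
    where
    -- Since D is closed, an edge meets D iff its first endpoint lies in D.
    starts-in-D? : Decidable (λ e → proj₁ e ∈ D)
    starts-in-D? e = proj₁ e ∈? D
    sub-matching : ∀ {P : Fin n × Fin n → Set} (P? : Decidable P) → IsMatching G' (filter P? M)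
    sub-matching P? = IsMatching-⊆ {G = G'} (filter-⊆ P? M) M-matching

proposition4p3 : ∀ {n} (G : Graph n) (C : Subset n) (w : Fin n)
    → IsComponent G C → (w∉C : w ∉ C)
    → ∀ (m : ℕ) → ∣ C ∣ ≡ 2 * m → IsMatchingNumber (induced G C) m
    → ∀ (k k' : ℕ) → IsMatchingNumber G k → IsMatchingNumber (rewire G C w w∉C) k'
    → k' ≤ k
proposition4p3 G C w (_ , _ , C-closed) w∉C m ∣C∣≡2m ((P , P-matching , ∣P∣≡m) , _)
               k k' (_ , ν≤k) ((M , M-matching , ∣M∣≡k') , _)
  with (R , B) , ∣M∣≡∣R∣+∣B∣ , 2∣R∣≤∣C∣+1 , B-matching , B∩C=∅
         ← Rewiring.matching-split G C w w∉C C-closed M-matching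
     | P-in-G , P⊆C ← IsMatching-induced {G = G} {C} P-matching
  = begin
  k'                   ≡⟨ sym ∣M∣≡k' ⟩
  length M             ≡⟨ ∣M∣≡∣R∣+∣B∣ ⟩
  length R + length B  ≤⟨ +-monoˡ-≤ (length B) ∣R∣≤m ⟩
  m + length B         ≡⟨ cong (_+ length B) (sym ∣P∣≡m) ⟩
  length P + length B  ≡⟨ length-++ P ⟨
  length (P ++ B)      ≤⟨ ν≤k (P ++ B) (IsMatching-++ {G = G} P⊆C B∩C=∅ P-in-G B-matching) ⟩
  k                    ∎
  where
  open ≤-Reasoning
  ∣R∣≤m : length R ≤ m
  ∣R∣≤m = 2*m≤2*n+1⇒m≤n (subst (λ c → 2 * length R ≤ c + 1) ∣C∣≡2m 2∣R∣≤∣C∣+1)
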